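{- Let $w\in W(\widetilde{C}_3)$ be fully commutative and non-cancellable, and let $k\ge1$. If $\mathbf{r}_{k+1}=s_1s_3$, then $\mathbf{r}_k=s_2s_4$; and if $\mathbf{r}_{k+1}=s_2s_4$, then $\mathbf{r}_k=s_1s_3$.
   Context: $W(\widetilde{C}_3)$ is the Coxeter group with generators $s_1,s_2,s_3,s_4$, $m(s_1,s_2)=m(s_3,s_4)=4$, $m(s_2,s_3)=3$, and $m(s_i,s_j)=2$ for $|i-j|\ge2$. $\mathcal{L},\mathcal{R}$ are left/right descent sets. Fully commutative: any two reduced expressions related by moves $st\mapsto ts$ with $m(s,t)=2$. A fully commutative $w$ is left weak star reducible by $s$ w.r.t. $t$ if $m(s,t)\ge3$, $s\in\mathcal{L}(w)$, $t\in\mathcal{L}(sw)$, and $tw$ is not fully commutative; right symmetrically; non-cancellable means neither left nor right weak star reducible by any $s$ w.r.t. any $t$. Heap: for fully commutative $w$ with reduced expression $s_{x_1}\cdots s_{x_r}$, the heap is the poset on $\{1,\dots,r\}$ (entry $p$ labeled $s_{x_p}$) generated by $p$ above $q$ whenever $p<q$ and $s_{x_p},s_{x_q}$ do not commute (including equal). An entry is in row 1 if nothing is above it; otherwise its row is $1$ plus the maximum row of entries covering it. $\mathbf{r}_k$ is the $k$-th row, and $\mathbf{r}_k=s_{y_1}\cdots s_{y_m}$ means the entries of row $k$ are labeled exactly by $s_{y_1},\dots,s_{y_m}$, each once. -}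

module Defs where

open import Data.Nat using (ℕ; zero; suc; _≤_; _<_; _⊔_; _≡ᵇ_)
open import Data.Bool using (Bool; true; false; if_then_else_)
open import Data.List using (List; []; _∷_; _++_; length; [_])
open import Data.Product using (Σ; ∃; _×_; _,_)
open import Relation.Nullary using (¬_)
open import Relation.Binary.PropositionalEquality using (_≡_)
open import Relation.Binary.Construct.Closure.Equivalence using (EqClosure)
open import Data.List.Relation.Binary.Permutation.Propositional using (_↭_)

data Gen : Set where
  s₁ s₂ s₃ s₄ : Gen

m : Gen → Gen → ℕ
m s₁ s₁ = 1
m s₂ s₂ = 1
m s₃ s₃ = 1
m s₄ s₄ = 1
m s₁ s₂ = 4
m s₂ s₁ = 4
m s₃ s₄ = 4
m s₄ s₃ = 4
m s₂ s₃ = 3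
m s₃ s₂ = 3
m _ _ = 2

Word : Set
Word = List Gen

alt : Gen → Gen → ℕ → Word
alt s t zero = []
alt s t (suc n) = s ∷ alt t s n

data CoxStep : Word → Word → Set where
  cancel : ∀ u v s → CoxStep (u ++ s ∷ s ∷ v) (u ++ v)
  braid  : ∀ u v s t → CoxStep (u ++ alt s t (m s t) ++ v) (u ++ alt t s (m s t) ++ v)

_~_ : Word → Word → Set
_~_ = EqClosure CoxStep

data ComStep : Word → Word → Set where
  comm : ∀ u v s t → m s t ≡ 2 → ComStep (u ++ s ∷ t ∷ v) (u ++ t ∷ s ∷ v)

_≈c_ : Word → Word → Set
_≈c_ = EqClosure ComStep

Reduced : Word → Set
Reduced u = ∀ v → v ~ u → length u ≤ length v

FC : Word → Set
FC w = ∀ u v → Reduced u → Reduced v → u ~ w → v ~ w → u ≈c v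

-- s ∈ 𝓛(w) :  ℓ(sw) < ℓ(w)
LDesc : Gen → Word → Set
LDesc s w = ∃ λ v → v ~ (s ∷ w) × (∀ u → u ~ w → length v < length u)

-- s ∈ 𝓡(w) :  ℓ(ws) < ℓ(w)
RDesc : Gen → Word → Set
RDesc s w = ∃ λ v → v ~ (w ++ [ s ]) × (∀ u → u ~ w → length v < length u)

LeftWeakStarRed : Word → Gen → Gen → Set
LeftWeakStarRed w s t =
  (3 ≤ m s t) × LDesc s w × LDesc t (s ∷ w) × ¬ FC (t ∷ w)

RightWeakStarRed : Word → Gen → Gen → Set
RightWeakStarRed w s t =
  (3 ≤ m s t) × RDesc s w × RDesc t (w ++ [ s ]) × ¬ FC (w ++ [ t ])

NonCancellable : Word → Set
NonCancellable w = ∀ s t → ¬ LeftWeakStarRed w s t × ¬ RightWeakStarRed w s t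

-- Heap rows.  For a word x₁⋯x_r, the row of position p is
-- 1 + max { row q | q < p, x_q and x_p do not commute }  (1 if none).
commutes : Gen → Gen → Bool
commutes s t = m s t ≡ᵇ 2

maxRow : List (Gen × ℕ) → Gen → ℕ
maxRow [] x = 0
maxRow ((y , r) ∷ prev) x =
  if commutes y x then maxRow prev x else r ⊔ maxRow prev x

rowsAcc : List (Gen × ℕ) → Word → List (Gen × ℕ)
rowsAcc prev [] = []
rowsAcc prev (x ∷ xs) = (x , r) ∷ rowsAcc ((x , r) ∷ prev) xs
  where r = suc (maxRow prev x)

heapRows : Word → List (Gen × ℕ)
heapRows w = rowsAcc [] w

labelsInRow : ℕ → List (Gen × ℕ) → Word
labelsInRow k [] = []
labelsInRow k ((x , r) ∷ es) =
  if r ≡ᵇ k then x ∷ labelsInRow k es else labelsInRow k es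

-- 𝐫_k = s_{y₁}⋯s_{y_m}: the labels of the entries in row k are exactly
-- y₁,…,y_m, each once (as a multiset)
RowIs : Word → ℕ → Word → Set
RowIs w k ys = labelsInRow k (heapRows w) ↭ ys

-- In the heap of w every row is pairwise commuting, and an entry in row r + 2 lies below a
-- non-commuting entry of row r + 1, which is not a copy of itself since w is reduced. Hence if
-- s₁ and s₃ lie in row k + 1, then s₂ lies in row k, and row k is {s₂} or {s₂, s₄}. Were it {s₂},
-- follow the entries above s₂: either the top of the heap is reached and w has a reduced
-- expression s₂s₃⋯ or s₁s₂s₁⋯, so w is left weak star reducible, or w has a reduced expression
-- containing s₃s₂s₃ or s₂s₁s₂s₁, and the braid relation yields a reduced expression outside the
-- commutation class of w. The second statement is the first one under the graph automorphism
-- s₁ ↔ s₄, s₂ ↔ s₃.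

module Submission where

open import Defs
open import Data.Bool using (Bool; true; false; not; _∧_; if_then_else_; T)
open import Data.Bool.Properties using (T-≡)
open import Data.Empty using (⊥; ⊥-elim)
open import Data.List using (List; []; _∷_; _++_; length; [_]; filter)
open import Data.List.Properties using (++-assoc; ++-cancelˡ; ∷-injectiveˡ; filter-++; filter-accept; filter-reject)
open import Data.List.Membership.Propositional using (_∈_)
open import Data.List.Relation.Binary.Subset.Propositional using (_⊆_)
open import Data.List.Relation.Binary.Permutation.Propositional using (_↭_; refl; swap; ↭-sym; ↭-trans)
open import Data.List.Relation.Binary.Permutation.Propositional.Properties using (∈-resp-↭)
open import Data.List.Relation.Unary.All as All using (All; []; _∷_)
open import Data.List.Relation.Unary.AllPairs using (AllPairs; []; _∷_)
open import Data.List.Relation.Unary.Any using (here; there)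
open import Data.Nat using (ℕ; zero; suc; _+_; _≤_; _<_; _≡ᵇ_; _<ᵇ_; _<?_; z≤n; s≤s; parity)
open import Data.Nat.Properties
  using (≤-trans; <-trans; <-irrefl; ≤-antisym; ≤-pred; n≤1+n; 1+n≰n; ≮⇒≥; m≤n⇒m<n∨m≡n; m≤m+n; m≤m⊔n; m≤n⊔m; ⊔-sel;
         <ᵇ⇒<; <⇒<ᵇ; ≡ᵇ⇒≡; ≡⇒≡ᵇ; suc-injective)
  renaming (_≟_ to _≟ℕ_)
open import Data.Parity.Properties using (suc-homo-⁻¹; p≢p⁻¹)
open import Data.Product using (∃; _×_; _,_; proj₁; proj₂)
import Data.Product as Product
open import Data.Sum using (_⊎_; inj₁; inj₂)
open import Function.Bundles using (Equivalence)
open import Relation.Nullary using (¬_; Dec; yes; no)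
open import Relation.Nullary.Decidable using (_⊎-dec_)
open import Relation.Binary.Definitions using (DecidableEquality)
open import Relation.Binary.Structures using (IsEquivalence)
open import Relation.Binary.PropositionalEquality using (_≡_; _≢_; refl; sym; trans; cong; subst; subst₂)
import Relation.Binary.PropositionalEquality as ≡
open import Relation.Binary.Construct.Closure.Equivalence using (gmap; gfold; return; isEquivalence; setoid)
import Relation.Binary.Reasoning.Setoid as SetoidReasoning

true⇒T : ∀ {b} → b ≡ true → T b
true⇒T = Equivalence.from T-≡

T⇒true : ∀ {b} → T b → b ≡ true
T⇒true = Equivalence.to T-≡

_≟_ : DecidableEquality Gen
s₁ ≟ s₁ = yes refl
s₂ ≟ s₂ = yes refl
s₃ ≟ s₃ = yes refl
s₄ ≟ s₄ = yes refl
s₁ ≟ s₂ = no λ ()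
s₁ ≟ s₃ = no λ ()
s₁ ≟ s₄ = no λ ()
s₂ ≟ s₁ = no λ ()
s₂ ≟ s₃ = no λ ()
s₂ ≟ s₄ = no λ ()
s₃ ≟ s₁ = no λ ()
s₃ ≟ s₂ = no λ ()
s₃ ≟ s₄ = no λ ()
s₄ ≟ s₁ = no λ ()
s₄ ≟ s₂ = no λ ()
s₄ ≟ s₃ = no λ ()

m-sym : ∀ s t → m s t ≡ m t s
m-sym s₁ s₁ = refl
m-sym s₁ s₂ = refl
m-sym s₁ s₃ = refl
m-sym s₁ s₄ = refl
m-sym s₂ s₁ = refl
m-sym s₂ s₂ = refl
m-sym s₂ s₃ = refl
m-sym s₂ s₄ = refl
m-sym s₃ s₁ = refl
m-sym s₃ s₂ = refl
m-sym s₃ s₃ = refl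
m-sym s₃ s₄ = refl
m-sym s₄ s₁ = refl
m-sym s₄ s₂ = refl
m-sym s₄ s₃ = refl
m-sym s₄ s₄ = refl

m-diag : ∀ s → m s s ≡ 1
m-diag s₁ = refl
m-diag s₂ = refl
m-diag s₃ = refl
m-diag s₄ = refl

Com : Gen → Gen → Set
Com s t = m s t ≡ 2

com-sym : ∀ {s t} → Com s t → Com t s
com-sym {s} {t} c = trans (m-sym t s) c

com-irrefl : ∀ {s} → ¬ Com s s
com-irrefl {s} c with trans (sym (m-diag s)) c
... | ()

commutes⇒Com : ∀ {s t} → commutes s t ≡ true → Com s t
commutes⇒Com {s} {t} e = ≡ᵇ⇒≡ (m s t) 2 (true⇒T e)

Com⇒commutes : ∀ {s t} → Com s t → commutes s t ≡ true
Com⇒commutes c rewrite c = refl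

¬commutes⇒¬Com : ∀ {s t} → commutes s t ≡ false → ¬ Com s t
¬commutes⇒¬Com e c with trans (sym (Com⇒commutes c)) e
... | ()

braid-not-commuting : ∀ {s t n} → m s t ≡ 3 + n → ¬ Com s t
braid-not-commuting e c with trans (sym e) c
... | ()

braid-distinct : ∀ {s t n} → m s t ≡ 3 + n → s ≢ t
braid-distinct {s} e refl with trans (sym (m-diag s)) e
... | ()

-- Commutation classes

module ≈c = IsEquivalence (isEquivalence ComStep)
module ~ = IsEquivalence (isEquivalence CoxStep)
module ≈c-Reasoning = SetoidReasoning (setoid ComStep)

≈c-∷ : ∀ s {u v} → u ≈c v → (s ∷ u) ≈c (s ∷ v)
≈c-∷ s = gmap (s ∷_) λ { (comm u v x y c) → comm (s ∷ u) v x y c }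

≈c-++ˡ : ∀ p {u v} → u ≈c v → (p ++ u) ≈c (p ++ v)
≈c-++ˡ []      u≈v = u≈v
≈c-++ˡ (s ∷ p) u≈v = ≈c-∷ s (≈c-++ˡ p u≈v)

≈c-++ʳ : ∀ q {u v} → u ≈c v → (u ++ q) ≈c (v ++ q)
≈c-++ʳ q = gmap (_++ q) step
  where
  step : ∀ {u v} → ComStep u v → ComStep (u ++ q) (v ++ q)
  step (comm u v s t c) rewrite ++-assoc u (s ∷ t ∷ v) q | ++-assoc u (t ∷ s ∷ v) q = comm u (v ++ q) s t c

~-∷ : ∀ s {u v} → u ~ v → (s ∷ u) ~ (s ∷ v)
~-∷ s = gmap (s ∷_) λ { (cancel u v x) → cancel (s ∷ u) v x ; (braid u v x y) → braid (s ∷ u) v x y }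

braid-step : ∀ {s t n} u v → m s t ≡ n → CoxStep (u ++ alt s t n ++ v) (u ++ alt t s n ++ v)
braid-step {s} {t} u v refl = braid u v s t

≈c⇒~ : ∀ {u v} → u ≈c v → u ~ v
≈c⇒~ = gmap (λ u → u) λ { (comm u v s t c) → braid-step u v c }

length-braid : ∀ p q s t k → length (p ++ alt s t k ++ q) ≡ length (p ++ alt t s k ++ q)
length-braid []      q s t zero    = refl
length-braid []      q s t (suc k) = cong suc (length-braid [] q t s k)
length-braid (x ∷ p) q s t k       = cong suc (length-braid p q s t k)

≈c-length : ∀ {u v} → u ≈c v → length u ≡ length v
≈c-length = gfold {R = ComStep} ≡.isEquivalence length λ { (comm u v s t _) → length-braid u v s t 2 }

length-cancel : ∀ (p q : Word) s → length (p ++ s ∷ s ∷ q) ≡ 2 + length (p ++ q)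
length-cancel []      q s = refl
length-cancel (x ∷ p) q s = cong suc (length-cancel p q s)

~-parity : ∀ {u v} → u ~ v → parity (length u) ≡ parity (length v)
~-parity = gfold {R = CoxStep} ≡.isEquivalence (λ u → parity (length u)) step
  where
  step : ∀ {u v} → CoxStep u v → parity (length u) ≡ parity (length v)
  step (cancel u v s)  = cong parity (length-cancel u v s)
  step (braid u v s t) = cong parity (length-braid u v s t (m s t))

parity-suc : ∀ n → parity n ≢ parity (suc n)
parity-suc n eq = p≢p⁻¹ (parity (suc n)) (trans (sym eq) (sym (suc-homo-⁻¹ n)))

commute-past : ∀ {s} u v → All (Com s) u → (s ∷ u ++ v) ≈c (u ++ s ∷ v)
commute-past     []      v []       = ≈c.refl
commute-past {s} (t ∷ u) v (c ∷ cs) = ≈c.trans (return (comm [] (u ++ v) s t c)) (≈c-∷ t (commute-past u v cs))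

commute-block : ∀ u v q → All (λ z → All (Com z) u) v → (v ++ u ++ q) ≈c (u ++ v ++ q)
commute-block u []      q []       = ≈c.refl
commute-block u (z ∷ v) q (c ∷ cs) = ≈c.trans (≈c-∷ z (commute-block u v q cs)) (commute-past u (v ++ q) c)

bring-to-front : ∀ {a B} → AllPairs Com B → a ∈ B → ∃ λ B′ → B ≈c (a ∷ B′) × All (Com a) B′ × B′ ⊆ B
bring-to-front (aB ∷ _) (here refl) = _ , ≈c.refl , aB , there
bring-to-front {a} {x ∷ B} (xB ∷ pairs) (there i) with bring-to-front pairs i
... | B′ , B≈ , aB′ , B′⊆B =
  x ∷ B′ , ≈c.trans (≈c-∷ x B≈) (return (comm [] B′ x a xa)) , com-sym xa ∷ aB′ ,
  λ { (here refl) → here refl ; (there j) → there (B′⊆B j) }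
  where
  xa : Com x a
  xa = All.lookup xB i

-- Commutation moves never swap two letters of {a, b}, so the subword on {a, b} is an invariant.
module OnPair {a b : Gen} (a≁b : ¬ Com a b) where

  InPair : Gen → Set
  InPair x = x ≡ a ⊎ x ≡ b

  inPair? : ∀ x → Dec (InPair x)
  inPair? x = (x ≟ a) ⊎-dec (x ≟ b)

  restrict : Word → Word
  restrict = filter inPair?

  pair-not-commuting : ∀ {s t} → InPair s → InPair t → ¬ Com s t
  pair-not-commuting (inj₁ refl) (inj₁ refl) = com-irrefl
  pair-not-commuting (inj₁ refl) (inj₂ refl) = a≁b
  pair-not-commuting (inj₂ refl) (inj₁ refl) = λ c → a≁b (com-sym c)
  pair-not-commuting (inj₂ refl) (inj₂ refl) = com-irrefl

  restrict-∷-cong : ∀ x {u v} → restrict u ≡ restrict v → restrict (x ∷ u) ≡ restrict (x ∷ v)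
  restrict-∷-cong x {u} {v} eq =
    trans (filter-++ inPair? [ x ] u) (trans (cong (restrict [ x ] ++_) eq) (sym (filter-++ inPair? [ x ] v)))

  restrict-swap : ∀ {s t} v → Com s t → restrict (s ∷ t ∷ v) ≡ restrict (t ∷ s ∷ v)
  restrict-swap {s} {t} v c with inPair? s | inPair? t
  ... | yes s∈ | yes t∈ = ⊥-elim (pair-not-commuting s∈ t∈ c)
  ... | _      | no t∉  = trans (restrict-∷-cong s (filter-reject inPair? t∉)) (sym (filter-reject inPair? t∉))
  ... | no s∉  | _      = trans (filter-reject inPair? s∉) (restrict-∷-cong t (sym (filter-reject inPair? s∉)))

  restrict-≈c : ∀ {u v} → u ≈c v → restrict u ≡ restrict v
  restrict-≈c = gfold {R = ComStep} ≡.isEquivalence restrict step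
    where
    step : ∀ {u v} → ComStep u v → restrict u ≡ restrict v
    step (comm u v s t c) = begin
      restrict (u ++ s ∷ t ∷ v)            ≡⟨ filter-++ inPair? u (s ∷ t ∷ v) ⟩
      restrict u ++ restrict (s ∷ t ∷ v)   ≡⟨ cong (restrict u ++_) (restrict-swap v c) ⟩
      restrict u ++ restrict (t ∷ s ∷ v)   ≡⟨ filter-++ inPair? u (t ∷ s ∷ v) ⟨
      restrict (u ++ t ∷ s ∷ v)            ∎
      where open ≡.≡-Reasoning

  restrict-at : ∀ p {x} u → InPair x → restrict (p ++ x ∷ u) ≡ restrict p ++ x ∷ restrict u
  restrict-at p {x} u x∈ = trans (filter-++ inPair? p (x ∷ u)) (cong (restrict p ++_) (filter-accept inPair? x∈))

heads-differ : ∀ {a b} → ¬ Com a b → a ≢ b → ∀ p {u v} → ¬ ((p ++ a ∷ u) ≈c (p ++ b ∷ v))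
heads-differ a≁b a≢b p {u} {v} eq = a≢b (∷-injectiveˡ (++-cancelˡ (restrict p) _ _ restrict-eq))
  where
  open OnPair a≁b
  restrict-eq : restrict p ++ _ ∷ restrict u ≡ restrict p ++ _ ∷ restrict v
  restrict-eq = trans (sym (restrict-at p u (inj₁ refl))) (trans (restrict-≈c eq) (restrict-at p v (inj₂ refl)))

reduced-resp : ∀ {w u} → Reduced w → u ~ w → length u ≡ length w → Reduced u
reduced-resp rw u~w eq v v~u = subst (_≤ length v) (sym eq) (rw v (~.trans v~u u~w))

no-square : ∀ {w} → Reduced w → ∀ p {s q} → ¬ (w ≈c (p ++ s ∷ s ∷ q))
no-square {w} rw p {s} {q} w≈ = 1+n≰n (≤-trans (n≤1+n _) (subst (_≤ length (p ++ q)) |w| (rw (p ++ q) shorter)))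
  where
  |w| : length w ≡ 2 + length (p ++ q)
  |w| = trans (≈c-length w≈) (length-cancel p q s)
  shorter : (p ++ q) ~ w
  shorter = ~.trans (~.sym (return (cancel p q s))) (~.sym (≈c⇒~ w≈))

no-braid : ∀ {w a b n} → Reduced w → FC w → m a b ≡ 3 + n → ∀ p {q} → ¬ (w ≈c (p ++ alt a b (3 + n) ++ q))
no-braid {w} {a} {b} {n} rw fc mab p {q} w≈ =
  heads-differ (braid-not-commuting mab) (braid-distinct mab) p
    (fc x y (reduced-resp rw x~w (sym (≈c-length w≈))) (reduced-resp rw y~w |y|) x~w y~w)
  where
  x y : Word
  x = p ++ alt a b (3 + n) ++ q
  y = p ++ alt b a (3 + n) ++ q
  x~w : x ~ w
  x~w = ~.sym (≈c⇒~ w≈)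
  y~w : y ~ w
  y~w = ~.trans (~.sym (return (braid-step p q mab))) x~w
  |y| : length y ≡ length w
  |y| = trans (sym (length-braid p q a b (3 + n))) (sym (≈c-length w≈))

-- By parity ℓ(b w) = ℓ(w) ± 1; were it ℓ(w) - 1, then w would have a reduced expression b v,
-- commutation equivalent to a ∷ u by full commutativity, which is impossible as a and b do not commute.
reduced-∷ : ∀ {w a b u} → Reduced w → FC w → w ≈c (a ∷ u) → ¬ Com a b → a ≢ b → Reduced (b ∷ w)
reduced-∷ {w} {a} {b} rw fc w≈ a≁b a≢b v v~bw with length w <? length v
... | yes |w|<|v| = |w|<|v|
... | no |w|≮|v| with m≤n⇒m<n∨m≡n (≮⇒≥ |w|≮|v|)
...   | inj₂ |v|≡|w| = ⊥-elim (parity-suc (length w) (trans (cong parity (sym |v|≡|w|)) (~-parity v~bw)))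
...   | inj₁ |v|<|w| = ⊥-elim (heads-differ (λ c → a≁b (com-sym c)) (λ e → a≢b (sym e)) [] (≈c.trans bv≈w w≈))
  where
  bv~w : (b ∷ v) ~ w
  bv~w = ~.trans (~-∷ b v~bw) (return (cancel [] w b))
  bv≈w : (b ∷ v) ≈c w
  bv≈w = fc (b ∷ v) w (reduced-resp rw bv~w (≤-antisym |v|<|w| (rw (b ∷ v) bv~w))) rw bv~w ~.refl

left-weak-star-red : ∀ {w a b n} r → Reduced w → FC w → m a b ≡ 3 + n → w ≈c (alt a b (2 + n) ++ r) →
                     LeftWeakStarRed w a b
left-weak-star-red {w} {a} {b} {n} r rw fc mab w≈ = 3≤m , a-descent , b-descent , ¬fc
  where
  rest : Word
  rest = alt a b n ++ r
  3≤m : 3 ≤ m a b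
  3≤m = subst (3 ≤_) (sym mab) (m≤m+n 3 n)
  |w| : length w ≡ 2 + length rest
  |w| = ≈c-length w≈
  w~ : w ~ (a ∷ b ∷ rest)
  w~ = ≈c⇒~ w≈
  b∷rest~a∷w : (b ∷ rest) ~ (a ∷ w)
  b∷rest~a∷w = ~.trans (~.sym (return (cancel [] (b ∷ rest) a))) (~-∷ a (~.sym w~))
  a-descent : LDesc a w
  a-descent = b ∷ rest , b∷rest~a∷w , λ u u~w → subst (_≤ length u) |w| (rw u u~w)
  b-descent : LDesc b (a ∷ w)
  b-descent = rest , ~.trans (~.sym (return (cancel [] rest b))) (~-∷ b b∷rest~a∷w)
            , λ u u~aw → ≤-pred (subst (_≤ suc (length u)) |w|
                                   (rw (a ∷ u) (~.trans (~-∷ a u~aw) (return (cancel [] w a)))))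
  ¬fc : ¬ FC (b ∷ w)
  ¬fc fc′ = no-braid (reduced-∷ rw fc w≈ (braid-not-commuting mab) (braid-distinct mab)) fc′
                     (trans (m-sym b a) mab) [] (≈c-∷ b w≈)

-- Heaps

Entry : Set
Entry = Gen × ℕ

labelsWhere : (ℕ → Bool) → List Entry → Word
labelsWhere p []             = []
labelsWhere p ((x , r) ∷ es) = if p r then x ∷ labelsWhere p es else labelsWhere p es

InOrder : Entry → Entry → Set
InOrder (x , r) (y , q) = Com x y ⊎ r < q

labelsInRow≡labelsWhere : ∀ r es → labelsInRow r es ≡ labelsWhere (λ q → q ≡ᵇ r) es
labelsInRow≡labelsWhere r []             = refl
labelsInRow≡labelsWhere r ((x , q) ∷ es) with q ≡ᵇ r
... | true  = cong (x ∷_) (labelsInRow≡labelsWhere r es)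
... | false = labelsInRow≡labelsWhere r es

labelsWhere-cong : ∀ {p p′} → (∀ q → p q ≡ p′ q) → ∀ es → labelsWhere p es ≡ labelsWhere p′ es
labelsWhere-cong eq [] = refl
labelsWhere-cong {p′ = p′} eq ((x , q) ∷ es) rewrite eq q with p′ q
... | true  = cong (x ∷_) (labelsWhere-cong eq es)
... | false = labelsWhere-cong eq es

labelsWhere-All : ∀ {p} {P : Gen → Set} es → All (λ e → p (proj₂ e) ≡ true → P (proj₁ e)) es →
                  All P (labelsWhere p es)
labelsWhere-All []             []       = []
labelsWhere-All {p} ((x , q) ∷ es) (h ∷ hs) with p q
... | true  = h refl ∷ labelsWhere-All es hs
... | false = labelsWhere-All es hs

∈-labelsWhere⁺ : ∀ {p es y q} → (y , q) ∈ es → p q ≡ true → y ∈ labelsWhere p es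
∈-labelsWhere⁺ {p} {(x , r) ∷ es} (here refl) pq rewrite pq = here refl
∈-labelsWhere⁺ {p} {(x , r) ∷ es} (there i)   pq with p r
... | true  = there (∈-labelsWhere⁺ i pq)
... | false = ∈-labelsWhere⁺ i pq

∈-labelsWhere⁻ : ∀ {p} es {y} → y ∈ labelsWhere p es → ∃ λ q → (y , q) ∈ es × p q ≡ true
∈-labelsWhere⁻ {p} ((x , r) ∷ es) i with p r in pr
∈-labelsWhere⁻ {p} ((x , r) ∷ es) (here refl) | true = r , here refl , pr
∈-labelsWhere⁻ {p} ((x , r) ∷ es) (there i)   | true = Product.map₂ (Product.map₁ there) (∈-labelsWhere⁻ es i)
∈-labelsWhere⁻ {p} ((x , r) ∷ es) i           | false = Product.map₂ (Product.map₁ there) (∈-labelsWhere⁻ es i)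

-- An entry selected by f but not by g commutes with the later entries selected by f ∧ g:
-- by closedness none of them lies in a lower row.
labelsWhere-split : (f g : ℕ → Bool) → (∀ {q q′} → q < q′ → f q ≡ true → (f q′ ∧ g q′) ≡ true → g q ≡ true) →
                    ∀ {es} → AllPairs InOrder es →
                    labelsWhere f es ≈c (labelsWhere (λ q → f q ∧ g q) es ++ labelsWhere (λ q → f q ∧ not (g q)) es)
labelsWhere-split f g closed [] = ≈c.refl
labelsWhere-split f g closed {(x , q) ∷ es} (x≤es ∷ ord) with f q in fq | g q in gq
... | false | _     = labelsWhere-split f g closed ord
... | true  | true  = ≈c-∷ x (labelsWhere-split f g closed ord)
... | true  | false = ≈c.trans (≈c-∷ x (labelsWhere-split f g closed ord))
                               (commute-past _ _ (labelsWhere-All es (All.map commutes-with-x x≤es)))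
  where
  commutes-with-x : ∀ {e} → InOrder (x , q) e → (f (proj₂ e) ∧ g (proj₂ e)) ≡ true → Com x (proj₁ e)
  commutes-with-x (inj₁ c)    _  = c
  commutes-with-x (inj₂ q<q′) fg with trans (sym (closed q<q′ fq fg)) gq
  ... | ()

labelsWhere-row-commuting : ∀ r {es} → AllPairs InOrder es → AllPairs Com (labelsWhere (λ q → q ≡ᵇ r) es)
labelsWhere-row-commuting r [] = []
labelsWhere-row-commuting r {(x , q) ∷ es} (x≤es ∷ ord) with q ≡ᵇ r in q≡r
... | true  = labelsWhere-All es (All.map same-row x≤es) ∷ labelsWhere-row-commuting r ord
  where
  same-row : ∀ {e} → InOrder (x , q) e → (proj₂ e ≡ᵇ r) ≡ true → Com x (proj₁ e)
  same-row         (inj₁ c)    _    = c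
  same-row {_ , q′} (inj₂ q<q′) q′≡r =
    ⊥-elim (<-irrefl (trans (≡ᵇ⇒≡ q r (true⇒T q≡r)) (sym (≡ᵇ⇒≡ q′ r (true⇒T q′≡r)))) q<q′)
... | false = labelsWhere-row-commuting r ord

not-<ᵇ-∧-≡ᵇ : ∀ r q → (not (q <ᵇ r) ∧ (q ≡ᵇ r)) ≡ (q ≡ᵇ r)
not-<ᵇ-∧-≡ᵇ zero    zero    = refl
not-<ᵇ-∧-≡ᵇ zero    (suc q) = refl
not-<ᵇ-∧-≡ᵇ (suc r) zero    = refl
not-<ᵇ-∧-≡ᵇ (suc r) (suc q) = not-<ᵇ-∧-≡ᵇ r q

not-<ᵇ-∧-not-≡ᵇ : ∀ r q → (not (q <ᵇ r) ∧ not (q ≡ᵇ r)) ≡ not (q <ᵇ suc r)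
not-<ᵇ-∧-not-≡ᵇ zero    zero    = refl
not-<ᵇ-∧-not-≡ᵇ zero    (suc q) = refl
not-<ᵇ-∧-not-≡ᵇ (suc r) zero    = refl
not-<ᵇ-∧-not-≡ᵇ (suc r) (suc q) = not-<ᵇ-∧-not-≡ᵇ r q

maxRow-bound : ∀ prev x {z q} → (z , q) ∈ prev → ¬ Com z x → q ≤ maxRow prev x
maxRow-bound ((y , r) ∷ prev) x (here refl) z≁x with commutes y x in c
... | true  = ⊥-elim (z≁x (commutes⇒Com c))
... | false = m≤m⊔n r (maxRow prev x)
maxRow-bound ((y , r) ∷ prev) x (there i) z≁x with commutes y x
... | true  = maxRow-bound prev x i z≁x
... | false = ≤-trans (maxRow-bound prev x i z≁x) (m≤n⊔m r (maxRow prev x))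

maxRow-attained : ∀ prev x {j} → maxRow prev x ≡ suc j → ∃ λ y → (y , suc j) ∈ prev × ¬ Com y x
maxRow-attained ((y , r) ∷ prev) x e with commutes y x in c
... | true = Product.map₂ (Product.map₁ there) (maxRow-attained prev x e)
... | false with ⊔-sel r (maxRow prev x)
...   | inj₁ r⊔≡r =
  y , subst (λ k → (y , k) ∈ ((y , r) ∷ prev)) (trans (sym r⊔≡r) e) (here refl) , ¬commutes⇒¬Com c
...   | inj₂ r⊔≡max = Product.map₂ (Product.map₁ there) (maxRow-attained prev x (trans (sym r⊔≡max) e))

rowsAcc-after : ∀ prev xs {e} → e ∈ prev → All (InOrder e) (rowsAcc prev xs)
rowsAcc-after prev []       _ = []
rowsAcc-after prev (x ∷ xs) {z , q} i = in-order ∷ rowsAcc-after _ xs (there i)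
  where
  in-order : InOrder (z , q) (x , suc (maxRow prev x))
  in-order with m z x ≟ℕ 2
  ... | yes c   = inj₁ c
  ... | no z≁x = inj₂ (s≤s (maxRow-bound prev x i z≁x))

rowsAcc-in-order : ∀ prev xs → AllPairs InOrder (rowsAcc prev xs)
rowsAcc-in-order prev []       = []
rowsAcc-in-order prev (x ∷ xs) = rowsAcc-after _ xs (here refl) ∷ rowsAcc-in-order _ xs

rowsAcc-labels : ∀ prev xs → labelsWhere (λ _ → true) (rowsAcc prev xs) ≡ xs
rowsAcc-labels prev []       = refl
rowsAcc-labels prev (x ∷ xs) = cong (x ∷_) (rowsAcc-labels _ xs)

rowsAcc-no-row-0 : ∀ prev xs → labelsWhere (_<ᵇ 1) (rowsAcc prev xs) ≡ []
rowsAcc-no-row-0 prev []       = refl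
rowsAcc-no-row-0 prev (x ∷ xs) = rowsAcc-no-row-0 _ xs

rowsAcc-supported : ∀ prev xs {x j} → (x , suc (suc j)) ∈ rowsAcc prev xs →
                    ∃ λ y → ((y , suc j) ∈ prev ⊎ (y , suc j) ∈ rowsAcc prev xs) × ¬ Com y x
rowsAcc-supported prev (x ∷ xs) (here eq) with cong proj₁ eq | maxRow-attained prev x (suc-injective (sym (cong proj₂ eq)))
... | refl | y , i , y≁x = y , inj₁ i , y≁x
rowsAcc-supported prev (x ∷ xs) (there i) with rowsAcc-supported _ xs i
... | y , inj₁ (here refl) , y≁x = y , inj₂ (here refl) , y≁x
... | y , inj₁ (there k)   , y≁x = y , inj₁ k , y≁x
... | y , inj₂ k           , y≁x = y , inj₂ (there k) , y≁x

module Heap (w : Word) where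

  row : ℕ → Word
  row r = labelsInRow r (heapRows w)

  prefix suffix : ℕ → Word
  prefix r = labelsWhere (_<ᵇ r) (heapRows w)
  suffix r = labelsWhere (λ q → not (q <ᵇ r)) (heapRows w)

  in-order : AllPairs InOrder (heapRows w)
  in-order = rowsAcc-in-order [] w

  ∈-row⁺ : ∀ {y r} → (y , r) ∈ heapRows w → y ∈ row r
  ∈-row⁺ {r = r} i =
    subst (_ ∈_) (sym (labelsInRow≡labelsWhere r (heapRows w))) (∈-labelsWhere⁺ i (T⇒true (≡⇒≡ᵇ r r refl)))

  ∈-row⁻ : ∀ {y r} → y ∈ row r → (y , r) ∈ heapRows w
  ∈-row⁻ {r = r} i with ∈-labelsWhere⁻ (heapRows w) (subst (_ ∈_) (labelsInRow≡labelsWhere r (heapRows w)) i)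
  ... | q , j , q≡r with ≡ᵇ⇒≡ q r (true⇒T q≡r)
  ...   | refl = j

  row-commuting : ∀ r → AllPairs Com (row r)
  row-commuting r = subst (AllPairs Com) (sym (labelsInRow≡labelsWhere r (heapRows w)))
                          (labelsWhere-row-commuting r in-order)

  row-supported : ∀ {x j} → x ∈ row (suc (suc j)) → ∃ λ y → y ∈ row (suc j) × ¬ Com y x
  row-supported x∈ with rowsAcc-supported [] w (∈-row⁻ x∈)
  ... | y , inj₂ i , y≁x = y , ∈-row⁺ i , y≁x

  w≈prefix++suffix : ∀ r → w ≈c (prefix r ++ suffix r)
  w≈prefix++suffix r = subst (_≈c (prefix r ++ suffix r)) (rowsAcc-labels [] w)
                             (labelsWhere-split (λ _ → true) (_<ᵇ r) closed in-order)
    where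
    closed : ∀ {q q′} → q < q′ → true ≡ true → (q′ <ᵇ r) ≡ true → (q <ᵇ r) ≡ true
    closed {q} {q′} q<q′ _ q′<r = T⇒true (<⇒<ᵇ (<-trans q<q′ (<ᵇ⇒< q′ r (true⇒T q′<r))))

  w≈suffix : w ≈c suffix 1
  w≈suffix = subst (λ p → w ≈c (p ++ suffix 1)) (rowsAcc-no-row-0 [] w) (w≈prefix++suffix 1)

  suffix-step : ∀ r → suffix r ≈c (row r ++ suffix (suc r))
  suffix-step r = subst₂ (λ u v → suffix r ≈c (u ++ v))
    (trans (labelsWhere-cong (not-<ᵇ-∧-≡ᵇ r) (heapRows w)) (sym (labelsInRow≡labelsWhere r (heapRows w))))
    (labelsWhere-cong (not-<ᵇ-∧-not-≡ᵇ r) (heapRows w))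
    (labelsWhere-split (λ q → not (q <ᵇ r)) (_≡ᵇ r) closed in-order)
    where
    closed : ∀ {q q′} → q < q′ → not (q <ᵇ r) ≡ true → (not (q′ <ᵇ r) ∧ (q′ ≡ᵇ r)) ≡ true → (q ≡ᵇ r) ≡ true
    closed {q} {q′} q<q′ q≮r q′≡r with ≡ᵇ⇒≡ q′ r (true⇒T (trans (sym (not-<ᵇ-∧-≡ᵇ r q′)) q′≡r))
    ... | refl with trans (sym (cong not (T⇒true (<⇒<ᵇ q<q′)))) q≮r
    ...   | ()

  suffix-∷ : ∀ {r b} u {t} → b ∈ row r → suffix (suc r) ≈c (u ++ t) →
             (∀ {z} → z ∈ row r → Com b z → All (Com z) u) → ∃ λ t′ → suffix r ≈c (b ∷ u ++ t′)
  suffix-∷ {r} {b} u {t} b∈ suffix≈ commute-with-u with bring-to-front (row-commuting r) b∈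
  ... | B′ , row≈ , bB′ , B′⊆row = B′ ++ t , (begin
    suffix r                  ≈⟨ suffix-step r ⟩
    row r ++ suffix (suc r)   ≈⟨ ≈c-++ʳ _ row≈ ⟩
    b ∷ B′ ++ suffix (suc r)  ≈⟨ ≈c-∷ b (≈c-++ˡ B′ suffix≈) ⟩
    b ∷ B′ ++ u ++ t          ≈⟨ ≈c-∷ b (commute-block u B′ t B′-commutes-with-u) ⟩
    b ∷ u ++ B′ ++ t          ∎)
    where
    open ≈c-Reasoning
    B′-commutes-with-u : All (λ z → All (Com z) u) B′
    B′-commutes-with-u = All.tabulate λ z∈ → commute-with-u (B′⊆row z∈) (All.lookup bB′ z∈)

  above : ∀ {r a t} → a ∈ row r → suffix (suc r) ≈c t → ∃ λ p → w ≈c (p ++ a ∷ t)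
  above {r} {a} {t} a∈ suffix≈ with bring-to-front (row-commuting r) a∈
  ... | B′ , row≈ , aB′ , _ = prefix r ++ B′ , (begin
    w                                     ≈⟨ w≈prefix++suffix r ⟩
    prefix r ++ suffix r                  ≈⟨ ≈c-++ˡ (prefix r) (suffix-step r) ⟩
    prefix r ++ row r ++ suffix (suc r)   ≈⟨ ≈c-++ˡ (prefix r) (≈c-++ʳ _ row≈) ⟩
    prefix r ++ a ∷ B′ ++ suffix (suc r)  ≈⟨ ≈c-++ˡ (prefix r) (≈c-∷ a (≈c-++ˡ B′ suffix≈)) ⟩
    prefix r ++ a ∷ B′ ++ t               ≈⟨ ≈c-++ˡ (prefix r) (commute-past B′ t aB′) ⟩
    prefix r ++ B′ ++ a ∷ t               ≡⟨ ++-assoc (prefix r) B′ (a ∷ t) ⟨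
    (prefix r ++ B′) ++ a ∷ t             ∎)
    where open ≈c-Reasoning

  rows-disjoint : ∀ {r a} → Reduced w → a ∈ row r → a ∈ row (suc r) → ⊥
  rows-disjoint rw a∈r a∈r+1 with suffix-∷ [] a∈r+1 ≈c.refl (λ _ _ → [])
  ... | t , suffix≈ with above a∈r suffix≈
  ...   | p , w≈ = no-square rw p w≈

-- Rows next to an end of the Coxeter graph

-- An end a =4= b -3- c of the graph, together with the generator d commuting with a and b.
record GraphEnd : Set where
  field
    a b c d      : Gen
    m-ab         : m a b ≡ 4
    m-bc         : m b c ≡ 3
    com-bd       : Com b d
    neighbours-a : ∀ y → ¬ Com y a → y ≡ a ⊎ y ≡ b
    neighbours-b : ∀ y → ¬ Com y b → y ≡ b ⊎ y ≡ a ⊎ y ≡ c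
    commuting-a  : ∀ z → Com a z → z ≡ c ⊎ z ≡ d
    commuting-b  : ∀ z → Com b z → z ≡ d

end-s₁ : GraphEnd
end-s₁ = record
  { a = s₁ ; b = s₂ ; c = s₃ ; d = s₄ ; m-ab = refl ; m-bc = refl ; com-bd = refl
  ; neighbours-a = λ { s₁ _ → inj₁ refl ; s₂ _ → inj₂ refl ; s₃ n → ⊥-elim (n refl) ; s₄ n → ⊥-elim (n refl) }
  ; neighbours-b = λ { s₂ _ → inj₁ refl ; s₁ _ → inj₂ (inj₁ refl) ; s₃ _ → inj₂ (inj₂ refl) ; s₄ n → ⊥-elim (n refl) }
  ; commuting-a  = λ { s₃ _ → inj₁ refl ; s₄ _ → inj₂ refl ; s₁ () ; s₂ () }
  ; commuting-b  = λ { s₄ _ → refl ; s₁ () ; s₂ () ; s₃ () }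
  }

end-s₄ : GraphEnd
end-s₄ = record
  { a = s₄ ; b = s₃ ; c = s₂ ; d = s₁ ; m-ab = refl ; m-bc = refl ; com-bd = refl
  ; neighbours-a = λ { s₄ _ → inj₁ refl ; s₃ _ → inj₂ refl ; s₂ n → ⊥-elim (n refl) ; s₁ n → ⊥-elim (n refl) }
  ; neighbours-b = λ { s₃ _ → inj₁ refl ; s₄ _ → inj₂ (inj₁ refl) ; s₂ _ → inj₂ (inj₂ refl) ; s₁ n → ⊥-elim (n refl) }
  ; commuting-a  = λ { s₂ _ → inj₁ refl ; s₁ _ → inj₂ refl ; s₄ () ; s₃ () }
  ; commuting-b  = λ { s₁ _ → refl ; s₄ () ; s₃ () ; s₂ () }
  }

commuting-list-shape : ∀ {b d B} → (∀ z → Com b z → z ≡ d) → AllPairs Com B → b ∈ B →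
                       B ≡ [ b ] ⊎ B ↭ b ∷ d ∷ []
commuting-list-shape {B = x ∷ []} only _ (here refl) = inj₁ refl
commuting-list-shape {B = x ∷ y ∷ []} only ((xy ∷ []) ∷ _) (here refl) with only y xy
... | refl = inj₂ refl
commuting-list-shape {B = x ∷ y ∷ []} only ((xy ∷ []) ∷ _) (there (here refl)) with only x (com-sym xy)
... | refl = inj₂ (swap _ _ refl)
commuting-list-shape {B = x ∷ y ∷ z ∷ B} only ((xy ∷ xz ∷ _) ∷ (yz ∷ _) ∷ _) (here refl)
  with only y xy | only z xz
... | refl | refl = ⊥-elim (com-irrefl yz)
commuting-list-shape {B = x ∷ y ∷ z ∷ B} only ((xy ∷ xz ∷ _) ∷ (yz ∷ _) ∷ _) (there (here refl))
  with only x (com-sym xy) | only z yz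
... | refl | refl = ⊥-elim (com-irrefl xz)
commuting-list-shape {B = x ∷ y ∷ z ∷ B} only ((xy ∷ xz ∷ xB) ∷ (yz ∷ yB) ∷ _) (there (there i))
  with only x (com-sym (All.lookup (xz ∷ xB) i)) | only y (com-sym (All.lookup (yz ∷ yB) i))
... | refl | refl = ⊥-elim (com-irrefl xy)

module RowsNearEnd (E : GraphEnd) {w : Word} (rw : Reduced w) (fc : FC w) (nc : NonCancellable w) where
  open GraphEnd E
  open Heap w

  ¬left-reducible : ∀ {s t} → ¬ LeftWeakStarRed w s t
  ¬left-reducible = proj₁ (nc _ _)

  singleton-row-suffix : ∀ {r x y} → row r ≡ [ x ] → y ∈ row (suc r) → ∃ λ t → suffix r ≈c (x ∷ y ∷ t)
  singleton-row-suffix {r} {x} e y∈ with suffix-∷ [] y∈ ≈c.refl (λ _ _ → [])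
  ... | t , suffix≈ =
    t , ≈c.trans (subst (λ B → suffix r ≈c (B ++ suffix (suc r))) e (suffix-step r)) (≈c-∷ x suffix≈)

  no-cbc-chain : ∀ {r} → row (suc r) ≡ [ b ] → c ∈ row (suc (suc r)) → c ∈ row r → ⊥
  no-cbc-chain e c∈ c∈′ with singleton-row-suffix e c∈
  ... | t , suffix≈ with above c∈′ suffix≈
  ...   | p , w≈ = no-braid rw fc (trans (m-sym c b) m-bc) p w≈

  aba-chain : ∀ {r} → row (suc r) ≡ [ b ] → a ∈ row (suc (suc r)) → a ∈ row r → ¬ c ∈ row r →
               ∃ λ t → suffix r ≈c (a ∷ b ∷ a ∷ t)
  aba-chain e a∈ a∈′ c∉ with singleton-row-suffix e a∈
  ... | t , suffix≈ = suffix-∷ (b ∷ a ∷ []) a∈′ suffix≈ commutes-with-ba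
    where
    commutes-with-ba : ∀ {z} → z ∈ _ → Com a z → All (Com z) (b ∷ a ∷ [])
    commutes-with-ba {z} z∈ az with commuting-a z az
    ... | inj₁ refl = ⊥-elim (c∉ z∈)
    ... | inj₂ refl = com-sym com-bd ∷ com-sym az ∷ []

  no-aba-chain : ∀ k {t} → a ∈ row (suc k) → ¬ (suffix (suc k) ≈c (a ∷ b ∷ a ∷ t))
  no-aba-chain zero    _  suffix≈ = ¬left-reducible (left-weak-star-red _ rw fc m-ab (≈c.trans w≈suffix suffix≈))
  no-aba-chain (suc k) a∈ suffix≈ with row-supported a∈
  ... | y , y∈ , y≁a with neighbours-a y y≁a
  ...   | inj₁ refl = rows-disjoint rw y∈ a∈
  ...   | inj₂ refl with above y∈ suffix≈
  ...     | p , w≈ = no-braid rw fc (trans (m-sym b a) m-ab) p w≈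

  row-not-just-b : ∀ k → row (suc k) ≡ [ b ] → a ∈ row (suc (suc k)) → c ∈ row (suc (suc k)) → ⊥
  row-not-just-b zero e a∈ c∈ with singleton-row-suffix e c∈
  ... | t , suffix≈ = ¬left-reducible (left-weak-star-red _ rw fc m-bc (≈c.trans w≈suffix suffix≈))
  row-not-just-b (suc k) e a∈ c∈ with row-supported (subst (b ∈_) (sym e) (here refl))
  ... | y , y∈ , y≁b with neighbours-b y y≁b
  ...   | inj₁ refl = rows-disjoint rw y∈ (subst (b ∈_) (sym e) (here refl))
  ...   | inj₂ (inj₂ refl) = no-cbc-chain e c∈ y∈
  ...   | inj₂ (inj₁ refl) with aba-chain e a∈ y∈ (no-cbc-chain e c∈)
  ...     | t , suffix≈ = no-aba-chain k y∈ suffix≈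

  b-supports-a : ∀ {k} → a ∈ row (suc (suc k)) → b ∈ row (suc k)
  b-supports-a a∈ with row-supported a∈
  ... | y , y∈ , y≁a with neighbours-a y y≁a
  ...   | inj₁ refl = ⊥-elim (rows-disjoint rw y∈ a∈)
  ...   | inj₂ refl = y∈

  row-above : ∀ k → RowIs w (suc (suc k)) (a ∷ c ∷ []) → RowIs w (suc k) (b ∷ d ∷ [])
  row-above k hyp = shape (commuting-list-shape commuting-b (row-commuting (suc k)) (b-supports-a a∈))
    where
    a∈ : a ∈ row (suc (suc k))
    a∈ = ∈-resp-↭ (↭-sym hyp) (here refl)
    c∈ : c ∈ row (suc (suc k))
    c∈ = ∈-resp-↭ (↭-sym hyp) (there (here refl))
    shape : row (suc k) ≡ [ b ] ⊎ row (suc k) ↭ b ∷ d ∷ [] → RowIs w (suc k) (b ∷ d ∷ [])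
    shape (inj₁ e) = ⊥-elim (row-not-just-b k e a∈ c∈)
    shape (inj₂ p) = p

lemma5p7 : (w : Word) → Reduced w → FC w → NonCancellable w →
    (k : ℕ) → 1 ≤ k →
    (RowIs w (suc k) (s₁ ∷ s₃ ∷ []) → RowIs w k (s₂ ∷ s₄ ∷ [])) ×
    (RowIs w (suc k) (s₂ ∷ s₄ ∷ []) → RowIs w k (s₁ ∷ s₃ ∷ []))
lemma5p7 w rw fc nc (suc k) (s≤s z≤n) =
  End₁.row-above k ,
  λ hyp → ↭-trans (End₄.row-above k (↭-trans hyp (swap _ _ refl))) (swap _ _ refl)
  where
  module End₁ = RowsNearEnd end-s₁ rw fc nc
  module End₄ = RowsNearEnd end-s₄ rw fc nc
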